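{- For all integers $n\ge 2$ we have $L_n<L_{n+1}$, and for all integers $n\ge 3$ we have $M_n<M_{n+1}$.
   Context: For $n\ge 0$, $[n]=\{1,\dots,n\}$. A partition $\pi$ of $[n]$ (into nonempty pairwise disjoint blocks) is noncrossing if there are no two distinct blocks $A,B$ of $\pi$ and elements $a<b$ in $A$, $c<d$ in $B$ with $a<c<b<d$. A noncrossing partition $\pi$ of $[n]$ is a marriageable singles partition if it has two distinct singleton blocks $\{i\},\{j\}$ ($i\ne j$) such that the partition obtained by replacing these two blocks with the block $\{i,j\}$ is still noncrossing; a noncrossing partition that is not a marriageable singles partition is a lonely singles partition. $M_n$ and $L_n$ denote the numbers of marriageable singles and lonely singles partitions of $[n]$, respectively. -}

module Defs where

open import Data.Bool using (Bool; true; false; _∧_; _∨_; not)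
open import Data.Nat using (ℕ; zero; suc)
open import Data.Fin using (Fin; _<?_; _≟_)
open import Data.Vec using (Vec; []; _∷_; lookup)
open import Data.List using (List; []; _∷_; [_]; map; concatMap; filterᵇ; length; allFin)
open import Data.Bool.ListAction using (all; any)
open import Relation.Nullary.Decidable using (⌊_⌋)

-- A binary relation on [n] = Fin n (element k of Fin n stands for k+1 ∈ [n]),
-- given as a Boolean-valued function.
BRel : ℕ → Set
BRel n = Fin n → Fin n → Bool

∀F : ∀ n → (Fin n → Bool) → Bool
∀F n p = all p (allFin n)

∃F : ∀ n → (Fin n → Bool) → Bool
∃F n p = any p (allFin n)

_⇒_ : Bool → Bool → Bool
a ⇒ b = not a ∨ b

_<ᵇ_ : ∀ {n} → Fin n → Fin n → Bool
a <ᵇ b = ⌊ a <? b ⌋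

_==_ : ∀ {n} → Fin n → Fin n → Bool
a == b = ⌊ a ≟ b ⌋

-- R is an equivalence relation (= a set partition of [n]; the blocks are
-- the equivalence classes, automatically nonempty and pairwise disjoint).
isEquiv : ∀ {n} → BRel n → Bool
isEquiv {n} R =
  ∀F n (λ x → R x x)
  ∧ ∀F n (λ x → ∀F n (λ y → R x y ⇒ R y x))
  ∧ ∀F n (λ x → ∀F n (λ y → ∀F n (λ z → (R x y ∧ R y z) ⇒ R x z)))

isNoncrossing : ∀ {n} → BRel n → Bool
isNoncrossing {n} R = not (∃F n λ a → ∃F n λ b → ∃F n λ c → ∃F n λ d →
  (a <ᵇ c) ∧ (c <ᵇ b) ∧ (b <ᵇ d) ∧ R a b ∧ R c d ∧ not (R a c))

isSingleton : ∀ {n} → BRel n → Fin n → Bool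
isSingleton {n} R i = ∀F n (λ j → R i j ⇒ (j == i))

merge : ∀ {n} → BRel n → Fin n → Fin n → BRel n
merge R i j x y = R x y ∨ (((x == i) ∨ (x == j)) ∧ ((y == i) ∨ (y == j)))

hasMarriageablePair : ∀ {n} → BRel n → Bool
hasMarriageablePair {n} R = ∃F n λ i → ∃F n λ j →
  not (i == j) ∧ isSingleton R i ∧ isSingleton R j ∧ isNoncrossing (merge R i j)

allVecs : ∀ {A : Set} → List A → (n : ℕ) → List (Vec A n)
allVecs xs zero = [ [] ]
allVecs xs (suc n) = concatMap (λ x → map (x ∷_) (allVecs xs n)) xs

-- All Boolean n×n matrices, i.e. all binary relations on [n] (each exactly once).
allRelMatrices : (n : ℕ) → List (Vec (Vec Bool n) n)
allRelMatrices n = allVecs (allVecs (true ∷ false ∷ []) n) n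

toRel : ∀ {n} → Vec (Vec Bool n) n → BRel n
toRel m x y = lookup (lookup m x) y

NCPartitions : (n : ℕ) → List (Vec (Vec Bool n) n)
NCPartitions n = filterᵇ (λ m → isEquiv (toRel m) ∧ isNoncrossing (toRel m)) (allRelMatrices n)

M : ℕ → ℕ
M n = length (filterᵇ (λ m → hasMarriageablePair (toRel m)) (NCPartitions n))

L : ℕ → ℕ
L n = length (filterᵇ (λ m → not (hasMarriageablePair (toRel m))) (NCPartitions n))

{-# OPTIONS --safe #-}
-- Both inequalities come from injections that are not surjective.  Prepending a singleton
-- block {1} maps marriageable singles partitions of [n] to marriageable ones of [n+1]; it
-- misses {1,2},{3},{4},… (for n+1 ≥ 4), which is marriageable via {3},{4}.  Adding a new
-- point 1 to the block of the old first point, i.e. pulling back along the monotone map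
-- [n+1] → [n] that identifies 1 and 2, keeps partitions noncrossing; neither 1 nor 2 is then
-- a singleton, so a marriageable pair of the new partition restricts to one of the old, and
-- lonely singles partitions go to lonely ones.  This misses {1},{2,…,n+1} (for n+1 ≥ 3),
-- which separates 1 from 2 and whose only singleton is {1}.  Both maps are injective because
-- restricting their values to {2,…,n+1} gives back the original partition.
module Submission where

open import Defs
open import Data.Bool using (Bool; true; false; _∧_; _∨_; not; T; T?)
open import Data.Bool.Properties using (T-∧; T-∨)
open import Data.Empty using (⊥; ⊥-elim)
open import Data.Fin as Fin using (Fin; zero; suc; toℕ; _≟_)
open import Data.Fin.Properties using (suc-injective; <-trans; ≤∧≢⇒<; <⇒≢)
open import Data.List using (List; []; _∷_; allFin; map; concatMap; cartesianProductWith; _++_; length; filterᵇ)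
open import Data.List.Properties using (length-map; length-removeAt′)
open import Data.List.Membership.Propositional using (_∈_; _─_)
open import Data.List.Membership.Propositional.Properties using (∈-allFin; ∈-map⁻; ∈-cartesianProductWith⁺; ∈-filter⁺; ∈-filter⁻)
open import Data.List.Relation.Binary.Subset.Propositional using (_⊆_)
import Data.List.Relation.Unary.All as All
open import Data.List.Relation.Unary.All.Properties using (all⁺; all⁻)
import Data.List.Relation.Unary.All.Properties as All
open import Data.List.Relation.Unary.AllPairs using ([]; _∷_)
open import Data.List.Relation.Unary.Any as Any using (here; there)
open import Data.List.Relation.Unary.Any.Properties using (any⁺; any⁻)
import Data.List.Relation.Unary.Any.Properties as Any
open import Data.List.Relation.Unary.Unique.Propositional using (Unique)
import Data.List.Relation.Unary.Unique.Propositional.Properties as Unique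
open import Data.Nat as ℕ using (ℕ; zero; suc; _+_; _≤_; _<_; s≤s; z≤n)
import Data.Nat.Properties as ℕ
open import Data.Product using (_×_; _,_; ∃; proj₁; proj₂; swap; uncurry)
open import Data.Product.Function.NonDependent.Propositional using (_×-⇔_)
open import Data.Sum using (_⊎_; inj₁; inj₂)
import Data.Sum as Sum
open import Data.Sum.Function.Propositional using (_⊎-⇔_)
open import Data.Unit using (tt)
open import Data.Vec using (Vec; []; _∷_; lookup; tabulate)
open import Data.Vec.Properties using (lookup∘tabulate; tabulate∘lookup; tabulate-cong; ∷-injective)
open import Function.Base using (_on_; _∘_; id; case_of_)
open import Function.Bundles using (_⇔_; mk⇔; Equivalence)
open import Function.Construct.Composition using (_⇔-∘_)
open import Function.Construct.Identity using (⇔-id)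
open import Level using (0ℓ)
open import Relation.Binary.Core using (Rel; _Preserves_⟶_)
open import Relation.Binary.Definitions using (Reflexive)
open import Relation.Binary.Structures using (IsEquivalence)
import Relation.Binary.Construct.On as On
open import Relation.Binary.PropositionalEquality using (_≡_; _≢_; refl; sym; trans; cong; subst; module ≡-Reasoning)
open import Relation.Nullary using (¬_; yes; no)
open import Relation.Nullary.Decidable using (toWitness; fromWitness; decidable-stable; ⌊⌋-map′)

open Equivalence using (to; from)

private variable
  n : ℕ

-- Reflecting the Boolean definitions

T-not : ∀ {b} → T (not b) ⇔ (¬ T b)
T-not {false} = mk⇔ (λ _ ()) (λ _ → tt)
T-not {true}  = mk⇔ (λ ()) (λ ¬t → ¬t tt)

T-⇒ : ∀ {a b} → T (a ⇒ b) ⇔ (T a → T b)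
T-⇒ {false} = mk⇔ (λ _ ()) (λ _ → tt)
T-⇒ {true}  = mk⇔ (λ t _ → t) (λ f → f tt)

T-∀F : ∀ {p : Fin n → Bool} → T (∀F n p) ⇔ (∀ x → T (p x))
T-∀F {n} {p} = mk⇔ (λ h x → All.lookup (all⁺ p (allFin n) h) (∈-allFin x))
                   (λ h → all⁻ p (All.tabulate⁺ h))

T-∃F : ∀ {p : Fin n → Bool} → T (∃F n p) ⇔ ∃ (T ∘ p)
T-∃F {n} {p} = mk⇔ (λ h → Any.satisfied (any⁻ p (allFin n) h))
                   (λ (x , px) → any⁺ p (Any.tabulate⁺ x px))

T-<ᵇ : ∀ {a b : Fin n} → T (a <ᵇ b) ⇔ a Fin.< b
T-<ᵇ = mk⇔ toWitness fromWitness

T-== : ∀ {a b : Fin n} → T (a == b) ⇔ a ≡ b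
T-== = mk⇔ toWitness fromWitness

T-pair : ∀ {x i j : Fin n} → T ((x == i) ∨ (x == j)) ⇔ (x ≡ i ⊎ x ≡ j)
T-pair = (T-== ⊎-⇔ T-==) ⇔-∘ T-∨

⟦_⟧ : BRel n → Rel (Fin n) 0ℓ
⟦ R ⟧ x y = T (R x y)

Noncrossing : BRel n → Set
Noncrossing R = ∀ a b c d → a Fin.< c → c Fin.< b → b Fin.< d → ⟦ R ⟧ a b → ⟦ R ⟧ c d → ⟦ R ⟧ a c

IsNCPartition : BRel n → Set
IsNCPartition R = IsEquivalence ⟦ R ⟧ × Noncrossing R

IsSingleton : BRel n → Fin n → Set
IsSingleton R i = ∀ j → ⟦ R ⟧ i j → j ≡ i

record MarriageablePair (R : BRel n) : Set where
  constructor marriageablePair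
  field
    {i j}       : Fin n
    i≢j         : i ≢ j
    singletonᵢ  : IsSingleton R i
    singletonⱼ  : IsSingleton R j
    noncrossing : Noncrossing (merge R i j)

T-isEquiv : ∀ {R : BRel n} → T (isEquiv R) ⇔ IsEquivalence ⟦ R ⟧
T-isEquiv {n} {R} = mk⇔ sound complete
  where
  Reflexive′ Symmetric′ Transitive′ : Bool
  Reflexive′  = ∀F n λ x → R x x
  Symmetric′  = ∀F n λ x → ∀F n λ y → R x y ⇒ R y x
  Transitive′ = ∀F n λ x → ∀F n λ y → ∀F n λ z → (R x y ∧ R y z) ⇒ R x z

  sound : T (isEquiv R) → IsEquivalence ⟦ R ⟧
  sound h = record
    { refl  = λ {x} → to T-∀F r x
    ; sym   = λ {x} {y} → to (T-⇒ {R x y}) (to T-∀F (to T-∀F s x) y)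
    ; trans = λ {x} {y} {z} p q →
        to (T-⇒ {R x y ∧ R y z}) (to T-∀F (to T-∀F (to T-∀F t x) y) z) (from T-∧ (p , q))
    }
    where
    r : T Reflexive′
    r = proj₁ (to (T-∧ {Reflexive′}) h)
    s : T Symmetric′
    s = proj₁ (to (T-∧ {Symmetric′}) (proj₂ (to (T-∧ {Reflexive′}) h)))
    t : T Transitive′
    t = proj₂ (to (T-∧ {Symmetric′}) (proj₂ (to (T-∧ {Reflexive′}) h)))

  complete : IsEquivalence ⟦ R ⟧ → T (isEquiv R)
  complete e = from (T-∧ {Reflexive′}) (r , from (T-∧ {Symmetric′}) (s , t))
    where
    module E = IsEquivalence e
    r : T Reflexive′
    r = from T-∀F λ x → E.refl {x}
    s : T Symmetric′
    s = from T-∀F λ x → from T-∀F λ y → from T-⇒ (E.sym {x} {y})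
    t : T Transitive′
    t = from T-∀F λ x → from T-∀F λ y → from T-∀F λ z → from T-⇒ λ pq →
      let p , q = to (T-∧ {R x y}) pq in E.trans {x} {y} {z} p q

T-isNoncrossing : ∀ {R : BRel n} → T (isNoncrossing R) ⇔ Noncrossing R
T-isNoncrossing {n} {R} = mk⇔ sound complete
  where
  Crossing : Fin n → Fin n → Fin n → Fin n → Bool
  Crossing a b c d = (a <ᵇ c) ∧ (c <ᵇ b) ∧ (b <ᵇ d) ∧ R a b ∧ R c d ∧ not (R a c)
  SomeCrossing : Bool
  SomeCrossing = ∃F n λ a → ∃F n λ b → ∃F n λ c → ∃F n λ d → Crossing a b c d

  sound : T (isNoncrossing R) → Noncrossing R
  sound h a b c d a<c c<b b<d ab cd = decidable-stable (T? (R a c)) λ ¬ac →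
    to (T-not {SomeCrossing}) h
      (from T-∃F (a , from T-∃F (b , from T-∃F (c , from T-∃F (d ,
        from T-∧ (from T-<ᵇ a<c , from T-∧ (from T-<ᵇ c<b , from T-∧ (from T-<ᵇ b<d ,
          from T-∧ (ab , from T-∧ (cd , from (T-not {R a c}) ¬ac))))))))))

  uncrossed : Noncrossing R → ∀ a b c d → ¬ T (Crossing a b c d)
  uncrossed nc a b c d h =
    let a<c , h   = to (T-∧ {a <ᵇ c}) h
        c<b , h   = to (T-∧ {c <ᵇ b}) h
        b<d , h   = to (T-∧ {b <ᵇ d}) h
        ab  , h   = to (T-∧ {R a b}) h
        cd  , ¬ac = to (T-∧ {R c d}) h
    in to (T-not {R a c}) ¬ac (nc a b c d (to T-<ᵇ a<c) (to T-<ᵇ c<b) (to T-<ᵇ b<d) ab cd)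

  complete : Noncrossing R → T (isNoncrossing R)
  complete nc = from (T-not {SomeCrossing}) λ h →
    let a , h = to T-∃F h
        b , h = to T-∃F h
        c , h = to T-∃F h
        d , h = to T-∃F h
    in uncrossed nc a b c d h

T-isSingleton : ∀ {R : BRel n} {i} → T (isSingleton R i) ⇔ IsSingleton R i
T-isSingleton {R = R} {i} = mk⇔
  (λ h j ij → to T-== (to (T-⇒ {R i j}) (to T-∀F h j) ij))
  (λ s → from T-∀F λ j → from T-⇒ λ ij → from T-== (s j ij))

T-merge : ∀ {R : BRel n} {i j x y} →
          ⟦ merge R i j ⟧ x y ⇔ (⟦ R ⟧ x y ⊎ (x ≡ i ⊎ x ≡ j) × (y ≡ i ⊎ y ≡ j))
T-merge = (⇔-id _ ⊎-⇔ ((T-pair ×-⇔ T-pair) ⇔-∘ T-∧)) ⇔-∘ T-∨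

T-hasMarriageablePair : ∀ {R : BRel n} → T (hasMarriageablePair R) ⇔ MarriageablePair R
T-hasMarriageablePair {n} {R} = mk⇔ sound complete
  where
  sound : T (hasMarriageablePair R) → MarriageablePair R
  sound h =
    let i , h   = to T-∃F h
        j , h   = to T-∃F h
        i≢j , h = to (T-∧ {not (i == j)}) h
        sᵢ , h  = to (T-∧ {isSingleton R i}) h
        sⱼ , nc = to (T-∧ {isSingleton R j}) h
    in marriageablePair (to (T-not {i == j}) i≢j ∘ from T-==)
         (to (T-isSingleton {R = R}) sᵢ) (to (T-isSingleton {R = R}) sⱼ)
         (to (T-isNoncrossing {R = merge R i j}) nc)

  complete : MarriageablePair R → T (hasMarriageablePair R)
  complete (marriageablePair {i} {j} i≢j sᵢ sⱼ nc) = from T-∃F (i , from T-∃F (j ,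
    from T-∧ (from T-not (i≢j ∘ to T-==) , from T-∧ (from (T-isSingleton {R = R}) sᵢ ,
      from T-∧ (from (T-isSingleton {R = R}) sⱼ , from (T-isNoncrossing {R = merge R i j}) nc)))))

T-lonely : ∀ {R : BRel n} → T (not (hasMarriageablePair R)) ⇔ (¬ MarriageablePair R)
T-lonely {R = R} = mk⇔
  (λ t → to (T-not {hasMarriageablePair R}) t ∘ from T-hasMarriageablePair)
  (λ l → from T-not (l ∘ to T-hasMarriageablePair))

-- Noncrossing partitions

_≐_ : BRel n → BRel n → Set
R ≐ S = ∀ x y → R x y ≡ S x y

≐-sym : ∀ {R S : BRel n} → R ≐ S → S ≐ R
≐-sym e x y = sym (e x y)

⟦⟧-resp-≐ : ∀ {R S : BRel n} → R ≐ S → ∀ {x y} → ⟦ R ⟧ x y → ⟦ S ⟧ x y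
⟦⟧-resp-≐ e {x} {y} = subst T (e x y)

isEquivalence-resp-≐ : ∀ {R S : BRel n} → R ≐ S → IsEquivalence ⟦ R ⟧ → IsEquivalence ⟦ S ⟧
isEquivalence-resp-≐ e eq = record
  { refl  = ⟦⟧-resp-≐ e E.refl
  ; sym   = ⟦⟧-resp-≐ e ∘ E.sym ∘ ⟦⟧-resp-≐ (≐-sym e)
  ; trans = λ p q → ⟦⟧-resp-≐ e (E.trans (⟦⟧-resp-≐ (≐-sym e) p) (⟦⟧-resp-≐ (≐-sym e) q))
  }
  where module E = IsEquivalence eq

Noncrossing-resp-≐ : ∀ {R S : BRel n} → R ≐ S → Noncrossing R → Noncrossing S
Noncrossing-resp-≐ e nc a b c d a<c c<b b<d ab cd =
  ⟦⟧-resp-≐ e (nc a b c d a<c c<b b<d (⟦⟧-resp-≐ (≐-sym e) ab) (⟦⟧-resp-≐ (≐-sym e) cd))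

MarriageablePair-resp-≐ : ∀ {R S : BRel n} → R ≐ S → MarriageablePair R → MarriageablePair S
MarriageablePair-resp-≐ e (marriageablePair i≢j sᵢ sⱼ nc) =
  marriageablePair i≢j (λ k → sᵢ k ∘ ⟦⟧-resp-≐ (≐-sym e)) (λ k → sⱼ k ∘ ⟦⟧-resp-≐ (≐-sym e))
    (Noncrossing-resp-≐ (λ x y → cong (_∨ _) (e x y)) nc)

==-suc : ∀ (a b : Fin n) → (suc a == suc b) ≡ (a == b)
==-suc a b = ⌊⌋-map′ (cong suc) suc-injective (a ≟ b)

merge-on-suc : ∀ (S : BRel (suc n)) i j → (merge S (suc i) (suc j) on suc) ≐ merge (S on suc) i j
merge-on-suc S i j x y rewrite ==-suc x i | ==-suc x j | ==-suc y i | ==-suc y j = refl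

Noncrossing-on-strictMono : ∀ {m} {R : BRel n} {f : Fin m → Fin n} →
                            f Preserves Fin._<_ ⟶ Fin._<_ → Noncrossing R → Noncrossing (R on f)
Noncrossing-on-strictMono {f = f} f-mono nc a b c d a<c c<b b<d =
  nc (f a) (f b) (f c) (f d) (f-mono a<c) (f-mono c<b) (f-mono b<d)

Noncrossing-on-mono : ∀ {m} {R : BRel n} {f : Fin m → Fin n} → IsEquivalence ⟦ R ⟧ →
                      f Preserves Fin._≤_ ⟶ Fin._≤_ → Noncrossing R → Noncrossing (R on f)
Noncrossing-on-mono {R = R} {f} eq f-mono nc a b c d a<c c<b b<d ab cd
  with f a ≟ f c | f c ≟ f b | f b ≟ f d
... | yes fa≡fc | _ | _ = subst (⟦ R ⟧ (f a)) fa≡fc (IsEquivalence.refl eq)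
... | no _ | yes fc≡fb | _ = subst (⟦ R ⟧ (f a)) (sym fc≡fb) ab
... | no _ | no _ | yes fb≡fd =
  IsEquivalence.trans eq ab (IsEquivalence.sym eq (subst (⟦ R ⟧ (f c)) (sym fb≡fd) cd))
... | no fa≢fc | no fc≢fb | no fb≢fd = nc (f a) (f b) (f c) (f d)
  (≤∧≢⇒< (f-mono (ℕ.<⇒≤ a<c)) fa≢fc) (≤∧≢⇒< (f-mono (ℕ.<⇒≤ c<b)) fc≢fb)
  (≤∧≢⇒< (f-mono (ℕ.<⇒≤ b<d)) fb≢fd) ab cd

Noncrossing-from-suc : ∀ {S : BRel (suc n)} → (∀ y → ⟦ S ⟧ zero y → y ≡ zero) →
                       Noncrossing (S on suc) → Noncrossing S
Noncrossing-from-suc isolated nc zero b c d a<c c<b b<d ab cd with isolated b ab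
... | refl = ⊥-elim (ℕ.n≮0 c<b)
Noncrossing-from-suc isolated nc (suc a) (suc b) (suc c) (suc d) a<c c<b b<d =
  nc a b c d (ℕ.s<s⁻¹ a<c) (ℕ.s<s⁻¹ c<b) (ℕ.s<s⁻¹ b<d)
Noncrossing-from-suc _ _ (suc _) _ zero _ () _ _
Noncrossing-from-suc _ _ (suc _) zero (suc _) _ _ () _
Noncrossing-from-suc _ _ (suc _) (suc _) (suc _) zero _ _ ()

between-adjacent : ∀ {i j x y z : Fin n} → toℕ j ≡ suc (toℕ i) →
                   x ≡ i ⊎ x ≡ j → y ≡ i ⊎ y ≡ j → x Fin.< z → z Fin.< y → ⊥
between-adjacent {i = i} {j} {x} {y} {z} j≡1+i x∈ij y∈ij x<z z<y =
  ℕ.<-irrefl refl (begin-strict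
    suc (toℕ i) ≤⟨ s≤s (above x∈ij) ⟩
    suc (toℕ x) ≤⟨ x<z ⟩
    toℕ z       <⟨ z<y ⟩
    toℕ y       ≤⟨ below y∈ij ⟩
    suc (toℕ i) ∎)
  where
  open ℕ.≤-Reasoning
  above : ∀ {w} → w ≡ i ⊎ w ≡ j → toℕ i ≤ toℕ w
  above (inj₁ refl) = ℕ.≤-refl
  above (inj₂ refl) = subst (toℕ i ≤_) (sym j≡1+i) (ℕ.n≤1+n _)
  below : ∀ {w} → w ≡ i ⊎ w ≡ j → toℕ w ≤ suc (toℕ i)
  below (inj₁ refl) = ℕ.n≤1+n _
  below (inj₂ refl) = ℕ.≤-reflexive j≡1+i

Noncrossing-merge-adjacent : ∀ {R : BRel n} {i j} → toℕ j ≡ suc (toℕ i) →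
                             Noncrossing R → Noncrossing (merge R i j)
Noncrossing-merge-adjacent {R = R} {i} {j} j≡1+i nc a b c d a<c c<b b<d ab cd
  with to (T-merge {R = R} {i} {j}) ab | to (T-merge {R = R} {i} {j}) cd
... | inj₁ Rab | inj₁ Rcd = from (T-merge {R = R}) (inj₁ (nc a b c d a<c c<b b<d Rab Rcd))
... | inj₂ (a∈ij , b∈ij) | _ = ⊥-elim (between-adjacent j≡1+i a∈ij b∈ij a<c c<b)
... | inj₁ _ | inj₂ (c∈ij , d∈ij) = ⊥-elim (between-adjacent j≡1+i c∈ij d∈ij c<b b<d)

oneBlock : (Fin n → Bool) → BRel n
oneBlock g x y = (x == y) ∨ (g x ∧ g y)

T-oneBlock : ∀ (g : Fin n → Bool) x {y} → ⟦ oneBlock g ⟧ x y ⇔ (x ≡ y ⊎ T (g x) × T (g y))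
T-oneBlock g x = (T-== ⊎-⇔ T-∧) ⇔-∘ T-∨

oneBlock-isEquivalence : ∀ (g : Fin n → Bool) → IsEquivalence ⟦ oneBlock g ⟧
oneBlock-isEquivalence g = record
  { refl  = λ {x} → from (T-oneBlock g x) (inj₁ refl)
  ; sym   = λ {x} {y} xy → from (T-oneBlock g y) (Sum.map sym swap (to (T-oneBlock g x) xy))
  ; trans = λ {x} {y} xy yz →
      from (T-oneBlock g x) (trans′ (to (T-oneBlock g x) xy) (to (T-oneBlock g y) yz))
  }
  where
  trans′ : ∀ {x y z} → x ≡ y ⊎ T (g x) × T (g y) → y ≡ z ⊎ T (g y) × T (g z) →
           x ≡ z ⊎ T (g x) × T (g z)
  trans′ (inj₁ refl) q = q
  trans′ p (inj₁ refl) = p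
  trans′ (inj₂ (gx , _)) (inj₂ (_ , gz)) = inj₂ (gx , gz)

Noncrossing-oneBlock : ∀ (g : Fin n → Bool) → Noncrossing (oneBlock g)
Noncrossing-oneBlock g a b c d a<c c<b b<d ab cd = from (T-oneBlock g a)
  (inj₂ (inBlock a ab (<⇒≢ (<-trans a<c c<b)) , inBlock c cd (<⇒≢ (<-trans c<b b<d))))
  where
  inBlock : ∀ x {y} → ⟦ oneBlock g ⟧ x y → x ≢ y → T (g x)
  inBlock x xy x≢y = Sum.[ ⊥-elim ∘ x≢y , proj₁ ] (to (T-oneBlock g x) xy)

oneBlock-isNCPartition : ∀ (g : Fin n → Bool) → IsNCPartition (oneBlock g)
oneBlock-isNCPartition g = oneBlock-isEquivalence g , Noncrossing-oneBlock g

oneBlock-singleton : ∀ (g : Fin n → Bool) {i} → ¬ T (g i) → IsSingleton (oneBlock g) i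
oneBlock-singleton g {i} ¬gi j ij = Sum.[ sym , ⊥-elim ∘ ¬gi ∘ proj₁ ] (to (T-oneBlock g i) ij)

oneBlock-nonSingleton : ∀ (g : Fin n → Bool) {i} j → T (g i) → T (g j) → i ≢ j →
                        ¬ IsSingleton (oneBlock g) i
oneBlock-nonSingleton g {i} j gi gj i≢j s = i≢j (sym (s j (from (T-oneBlock g i) (inj₂ (gi , gj)))))

-- The two extensions from [n] to [n+1]

prependSingleton : BRel n → BRel (suc n)
prependSingleton R zero    zero    = true
prependSingleton R zero    (suc _) = false
prependSingleton R (suc _) zero    = false
prependSingleton R (suc x) (suc y) = R x y

prependSingleton-isEquivalence : ∀ {R : BRel n} → IsEquivalence ⟦ R ⟧ →
                                 IsEquivalence ⟦ prependSingleton R ⟧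
prependSingleton-isEquivalence {R = R} eq = record
  { refl  = λ {x} → refl′ x
  ; sym   = λ {x} {y} → sym′ x y
  ; trans = λ {x} {y} {z} → trans′ x y z
  }
  where
  module E = IsEquivalence eq
  S = prependSingleton R
  refl′ : ∀ x → ⟦ S ⟧ x x
  refl′ zero    = tt
  refl′ (suc _) = E.refl
  sym′ : ∀ x y → ⟦ S ⟧ x y → ⟦ S ⟧ y x
  sym′ zero    zero    _  = tt
  sym′ (suc _) (suc _) xy = E.sym xy
  trans′ : ∀ x y z → ⟦ S ⟧ x y → ⟦ S ⟧ y z → ⟦ S ⟧ x z
  trans′ zero    zero    zero    _  _  = tt
  trans′ (suc _) (suc _) (suc _) xy yz = E.trans xy yz

prependSingleton-isolated : ∀ {R : BRel n} y → ⟦ prependSingleton R ⟧ zero y → y ≡ zero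
prependSingleton-isolated zero _ = refl

prependSingleton-isNCPartition : ∀ {R : BRel n} → IsNCPartition R → IsNCPartition (prependSingleton R)
prependSingleton-isNCPartition (eq , nc) =
  prependSingleton-isEquivalence eq , Noncrossing-from-suc prependSingleton-isolated nc

marriageablePair-prependSingleton : ∀ {R : BRel n} → MarriageablePair R →
                                    MarriageablePair (prependSingleton R)
marriageablePair-prependSingleton {R = R} (marriageablePair {i} {j} i≢j sᵢ sⱼ nc) =
  marriageablePair (i≢j ∘ suc-injective) (singleton sᵢ) (singleton sⱼ)
    (Noncrossing-from-suc isolated
      (Noncrossing-resp-≐ (≐-sym (merge-on-suc (prependSingleton R) i j)) nc))
  where
  isolated : ∀ y → ⟦ merge (prependSingleton R) (suc i) (suc j) ⟧ zero y → y ≡ zero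
  isolated zero _ = refl
  singleton : ∀ {k} → IsSingleton R k → IsSingleton (prependSingleton R) (suc k)
  singleton s (suc l) kl = cong suc (s l kl)

collapse : Fin (suc (suc n)) → Fin (suc n)
collapse zero    = zero
collapse (suc x) = x

collapse-mono : collapse {n} Preserves Fin._≤_ ⟶ Fin._≤_
collapse-mono {x = zero}          _   = z≤n
collapse-mono {x = suc _} {suc _} x≤y = ℕ.s≤s⁻¹ x≤y

on-collapse-isNCPartition : ∀ {R : BRel (suc n)} → IsNCPartition R → IsNCPartition (R on collapse)
on-collapse-isNCPartition (eq , nc) =
  On.isEquivalence collapse eq , Noncrossing-on-mono eq collapse-mono nc

marriageablePair-on-collapse⁻ : ∀ {R : BRel (suc n)} → Reflexive ⟦ R ⟧ →
                                MarriageablePair (R on collapse) → MarriageablePair R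
marriageablePair-on-collapse⁻ r (marriageablePair {zero} _ sᵢ _ _) with sᵢ (suc zero) r
... | ()
marriageablePair-on-collapse⁻ r (marriageablePair {suc _} {zero} _ _ sⱼ _) with sⱼ (suc zero) r
... | ()
marriageablePair-on-collapse⁻ {R = R} r (marriageablePair {suc i} {suc j} i≢j sᵢ sⱼ nc) =
  marriageablePair (i≢j ∘ cong suc)
    (λ k → suc-injective ∘ sᵢ (suc k)) (λ k → suc-injective ∘ sⱼ (suc k))
    (Noncrossing-resp-≐ (merge-on-suc (R on collapse) i j) (Noncrossing-on-strictMono ℕ.s<s nc))

-- Counting

Mat : ℕ → Set
Mat n = Vec (Vec Bool n) n

fromRel : BRel n → Mat n
fromRel R = tabulate (tabulate ∘ R)

toRel-fromRel : ∀ (R : BRel n) → toRel (fromRel R) ≐ R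
toRel-fromRel R x y =
  trans (cong (λ row → lookup row y) (lookup∘tabulate (tabulate ∘ R) x)) (lookup∘tabulate (R x) y)

fromRel-toRel : ∀ (m : Mat n) → fromRel (toRel m) ≡ m
fromRel-toRel m = trans (tabulate-cong (tabulate∘lookup ∘ lookup m)) (tabulate∘lookup m)

fromRel-injective : ∀ {R S : BRel n} → fromRel R ≡ fromRel S → R ≐ S
fromRel-injective {R = R} {S} e x y =
  trans (sym (toRel-fromRel R x y)) (trans (cong (λ m → toRel m x y) e) (toRel-fromRel S x y))

toRel-injective : ∀ {m m′ : Mat n} → toRel m ≐ toRel m′ → m ≡ m′
toRel-injective {m = m} {m′} e = begin
  m                  ≡⟨ fromRel-toRel m ⟨
  fromRel (toRel m)  ≡⟨ tabulate-cong (λ x → tabulate-cong (e x)) ⟩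
  fromRel (toRel m′) ≡⟨ fromRel-toRel m′ ⟩
  m′                 ∎
  where open ≡-Reasoning

concatMap-map≡cartesianProductWith : ∀ {A B C : Set} (f : A → B → C) xs ys →
  concatMap (λ x → map (f x) ys) xs ≡ cartesianProductWith f xs ys
concatMap-map≡cartesianProductWith f []       ys = refl
concatMap-map≡cartesianProductWith f (x ∷ xs) ys =
  cong (map (f x) ys ++_) (concatMap-map≡cartesianProductWith f xs ys)

∈-allVecs : ∀ {A : Set} {xs : List A} → (∀ x → x ∈ xs) → ∀ n (v : Vec A n) → v ∈ allVecs xs n
∈-allVecs all∈ zero    []      = here refl
∈-allVecs {xs = xs} all∈ (suc n) (x ∷ v) =
  subst (x ∷ v ∈_) (sym (concatMap-map≡cartesianProductWith _∷_ xs (allVecs xs n)))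
    (∈-cartesianProductWith⁺ _∷_ (all∈ x) (∈-allVecs all∈ n v))

allVecs-unique : ∀ {A : Set} {xs : List A} → Unique xs → ∀ n → Unique (allVecs xs n)
allVecs-unique u zero    = All.[] ∷ []
allVecs-unique {xs = xs} u (suc n) =
  subst Unique (sym (concatMap-map≡cartesianProductWith _∷_ xs (allVecs xs n)))
    (Unique.cartesianProductWith⁺ _∷_ ∷-injective u (allVecs-unique u n))

∈-allRelMatrices : ∀ (m : Mat n) → m ∈ allRelMatrices n
∈-allRelMatrices {n} = ∈-allVecs (∈-allVecs ∈-bools n) n
  where
  ∈-bools : ∀ b → b ∈ true ∷ false ∷ []
  ∈-bools true  = here refl
  ∈-bools false = there (here refl)

allRelMatrices-unique : Unique (allRelMatrices n)
allRelMatrices-unique {n} = allVecs-unique (allVecs-unique (((λ ()) All.∷ All.[]) ∷ All.[] ∷ []) n) n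

∈-─ : ∀ {A : Set} {x y : A} {ys} (x∈ys : x ∈ ys) → y ∈ ys → y ≢ x → y ∈ ys ─ x∈ys
∈-─ (here refl)  (here refl)  y≢x = ⊥-elim (y≢x refl)
∈-─ (here _)     (there y∈ys) _   = y∈ys
∈-─ (there _)    (here refl)  _   = here refl
∈-─ (there x∈ys) (there y∈ys) y≢x = there (∈-─ x∈ys y∈ys y≢x)

Unique-⊆⇒length≤ : ∀ {A : Set} {xs ys : List A} → Unique xs → xs ⊆ ys → length xs ≤ length ys
Unique-⊆⇒length≤ {xs = []}     _              _   = z≤n
Unique-⊆⇒length≤ {xs = x ∷ xs} {ys} (x∉xs ∷ u) sub = begin
  suc (length xs)          ≤⟨ s≤s (Unique-⊆⇒length≤ u xs⊆ys─x) ⟩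
  suc (length (ys ─ x∈ys)) ≡⟨ length-removeAt′ ys (Any.index x∈ys) ⟨
  length ys                ∎
  where
  open ℕ.≤-Reasoning
  x∈ys = sub (here refl)
  xs⊆ys─x : xs ⊆ ys ─ x∈ys
  xs⊆ys─x y∈xs = ∈-─ x∈ys (sub (there y∈xs)) (All.lookup x∉xs y∈xs ∘ sym)

injective-missing⇒length< : ∀ {A B : Set} {xs : List A} {zs : List B} {f : A → B} {w : B} →
  Unique xs → (∀ {a b} → f a ≡ f b → a ≡ b) → (∀ {a} → a ∈ xs → f a ∈ zs) →
  w ∈ zs → (∀ {a} → a ∈ xs → f a ≢ w) → length xs < length zs
injective-missing⇒length< {xs = xs} {zs} {f} {w} u f-inj f∈zs w∈zs f≢w =
  subst (_≤ length zs) (cong suc (length-map f xs))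
    (Unique-⊆⇒length≤ (All.map⁺ (All.tabulate λ a∈xs → f≢w a∈xs ∘ sym) ∷ Unique.map⁺ f-inj u) w∷fxs⊆zs)
  where
  w∷fxs⊆zs : w ∷ map f xs ⊆ zs
  w∷fxs⊆zs (here refl) = w∈zs
  w∷fxs⊆zs (there v∈fxs) with ∈-map⁻ f v∈fxs
  ... | _ , a∈xs , refl = f∈zs a∈xs

count : (∀ {k} → BRel k → Bool) → ℕ → ℕ
count φ n = length (filterᵇ (λ m → φ (toRel m)) (NCPartitions n))

∈-filter-NCPartitions : ∀ {φ : BRel n → Bool} {m : Mat n} →
  m ∈ filterᵇ (φ ∘ toRel) (NCPartitions n) ⇔ (IsNCPartition (toRel m) × T (φ (toRel m)))
∈-filter-NCPartitions {n} {φ} {m} = mk⇔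
  (λ m∈ → let m∈NC , φm = ∈-filter⁻ (T? ∘ φ ∘ toRel) m∈
              _ , ok    = ∈-filter⁻ (T? ∘ isNCPartition) {xs = allRelMatrices n} m∈NC
              eq , nc   = to (T-∧ {isEquiv (toRel m)}) ok
          in (to T-isEquiv eq , to T-isNoncrossing nc) , φm)
  (λ ((eq , nc) , φm) → ∈-filter⁺ (T? ∘ φ ∘ toRel)
     (∈-filter⁺ (T? ∘ isNCPartition) (∈-allRelMatrices m)
        (from (T-∧ {isEquiv (toRel m)}) (from T-isEquiv eq , from T-isNoncrossing nc))) φm)
  where
  isNCPartition : Mat n → Bool
  isNCPartition m = isEquiv (toRel m) ∧ isNoncrossing (toRel m)

count-< : ∀ {n} (φ : ∀ {k} → BRel k → Bool) (P : ∀ {k} → BRel k → Set)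
  (T-φ : ∀ {k} {R : BRel k} → T (φ R) ⇔ P R)
  (P-resp : ∀ {R S : BRel (suc n)} → R ≐ S → P R → P S)
  (E : BRel n → BRel (suc n)) (E-on-suc : ∀ R → (E R on suc) ≐ R)
  (E-valid : ∀ {R} → IsNCPartition R → P R → IsNCPartition (E R) × P (E R))
  (W : BRel (suc n)) (W-partition : IsNCPartition W) (W-P : P W)
  (W-new : ∀ {R} → IsNCPartition R → ¬ E R ≐ W) →
  count φ n < count φ (suc n)
count-< {n} φ P T-φ P-resp E E-on-suc E-valid W W-partition W-P W-new =
  injective-missing⇒length< (Unique.filter⁺ _ (Unique.filter⁺ _ allRelMatrices-unique))
    f-injective f∈ (valid⇒∈ W-partition W-P)
    (λ a∈ → W-new (proj₁ (to (∈-filter-NCPartitions {φ = φ}) a∈)) ∘ fromRel-injective)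
  where
  f : Mat n → Mat (suc n)
  f = fromRel ∘ E ∘ toRel

  valid⇒∈ : ∀ {R} → IsNCPartition R → P R → fromRel R ∈ filterᵇ (φ ∘ toRel) (NCPartitions (suc n))
  valid⇒∈ {R} (eq , nc) p = from (∈-filter-NCPartitions {φ = φ})
    ((isEquivalence-resp-≐ back eq , Noncrossing-resp-≐ back nc) , from T-φ (P-resp back p))
    where
    back : R ≐ toRel (fromRel R)
    back = ≐-sym (toRel-fromRel R)

  f-injective : ∀ {a b} → f a ≡ f b → a ≡ b
  f-injective {a} {b} e = toRel-injective λ x y → begin
    toRel a x y                ≡⟨ E-on-suc (toRel a) x y ⟨
    E (toRel a) (suc x) (suc y) ≡⟨ fromRel-injective {R = E (toRel a)} {E (toRel b)} e (suc x) (suc y) ⟩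
    E (toRel b) (suc x) (suc y) ≡⟨ E-on-suc (toRel b) x y ⟩
    toRel b x y                ∎
    where open ≡-Reasoning

  f∈ : ∀ {a} → a ∈ filterᵇ (φ ∘ toRel) (NCPartitions n) → f a ∈ filterᵇ (φ ∘ toRel) (NCPartitions (suc n))
  f∈ a∈ = let partition , φa = to (∈-filter-NCPartitions {φ = φ}) a∈
          in uncurry valid⇒∈ (E-valid partition (to T-φ φa))

firstTwo : Fin n → Bool
firstTwo zero          = true
firstTwo (suc zero)    = true
firstTwo (suc (suc _)) = false

notFirst : Fin n → Bool
notFirst zero    = false
notFirst (suc _) = true

M-growth : ∀ k → M (3 + k) < M (4 + k)
M-growth k = count-< {3 + k} hasMarriageablePair MarriageablePair T-hasMarriageablePair
  MarriageablePair-resp-≐ prependSingleton (λ _ _ _ → refl)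
  (λ partition mp → prependSingleton-isNCPartition partition , marriageablePair-prependSingleton mp)
  W (oneBlock-isNCPartition firstTwo) W-marriageable (λ _ e → case e zero (suc zero) of λ ())
  where
  W = oneBlock firstTwo
  W-marriageable : MarriageablePair W
  W-marriageable = marriageablePair {i = suc (suc zero)} {suc (suc (suc zero))} (λ ())
    (oneBlock-singleton firstTwo id) (oneBlock-singleton firstTwo id)
    (Noncrossing-merge-adjacent refl (Noncrossing-oneBlock firstTwo))

L-growth : ∀ k → L (2 + k) < L (3 + k)
L-growth k = count-< {2 + k} (λ R → not (hasMarriageablePair R)) (λ R → ¬ MarriageablePair R) T-lonely
  (λ e l → l ∘ MarriageablePair-resp-≐ (≐-sym e)) (_on collapse) (λ _ _ _ → refl)
  (λ partition l → on-collapse-isNCPartition partition ,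
                   l ∘ marriageablePair-on-collapse⁻ (IsEquivalence.refl (proj₁ partition)))
  W (oneBlock-isNCPartition notFirst) W-lonely
  (λ (eq , _) e → subst T (e zero (suc zero)) (IsEquivalence.refl eq))
  where
  W = oneBlock notFirst
  singleton⇒zero : ∀ {i} → IsSingleton W i → i ≡ zero
  singleton⇒zero {zero}          _ = refl
  singleton⇒zero {suc zero}      s = ⊥-elim (oneBlock-nonSingleton notFirst (suc (suc zero)) tt tt (λ ()) s)
  singleton⇒zero {suc (suc _)}   s = ⊥-elim (oneBlock-nonSingleton notFirst (suc zero) tt tt (λ ()) s)
  W-lonely : ¬ MarriageablePair W
  W-lonely (marriageablePair i≢j sᵢ sⱼ _) = i≢j (trans (singleton⇒zero sᵢ) (sym (singleton⇒zero sⱼ)))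

proposition20 : ((n : ℕ) → 2 ≤ n → L n < L (suc n)) × ((n : ℕ) → 3 ≤ n → M n < M (suc n))
proposition20 = lonely , marriageable
  where
  lonely : (n : ℕ) → 2 ≤ n → L n < L (suc n)
  lonely (suc (suc k)) _ = L-growth k
  lonely 1 (s≤s ())
  marriageable : (n : ℕ) → 3 ≤ n → M n < M (suc n)
  marriageable (suc (suc (suc k))) _ = M-growth k
  marriageable 1 (s≤s ())
  marriageable 2 (s≤s (s≤s ()))
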